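{- Let $n,m$ be positive integers, $0\le r\le\min\{m,n\}$, $0<d\le r$, and let $\lambda^{(1)}\vdash n$, $\lambda^{(2)}\vdash m$ with $\lambda^{(1)}_1\le n+m-d-r$ and $\lambda^{(2)}_1\le n+m-d-r$. Then the map $\Phi_{d,\lambda^{(1)},\lambda^{(2)}}:H(d,\lambda^{(1)},\lambda^{(2)})\setminus H^{+}(d,\lambda^{(1)},\lambda^{(2)})\to H(d-1,\lambda^{(1)},\lambda^{(2)})$ is bijective.
   Context: Young diagrams are placed in the grid $\mathbb{Z}_{>0}\times\mathbb{Z}_{>0}$ with upper-left corners aligned; $\lambda/\mu$ is a horizontal strip if $\mu\subseteq\lambda$ and $\lambda/\mu$ has at most one cell per column. $H(k,\lambda^{(1)},\lambda^{(2)})$ is the set of partitions $\mu\vdash k$ such that $\lambda^{(1)}/\mu$ and $\lambda^{(2)}/\mu$ are both horizontal strips. For such $\mu$, the lattice path $\mathrm{LP}(\mu,\lambda^{(1)},\lambda^{(2)})$ starts at $(0,0)$ and has infinitely many steps; its $i$-th step is $(1,1)$ if column $i$ contains a cell of both $\lambda^{(1)}/\mu$ and $\lambda^{(2)}/\mu$, $(1,-1)$ if it contains a cell of neither, and $(1,0)$ otherwise. $H^{+}(d,\lambda^{(1)},\lambda^{(2)})$ is the set of $\mu\in H(d,\lambda^{(1)},\lambda^{(2)})$ such that the first $\max\{\lambda^{(1)}_1,\lambda^{(2)}_1\}$ steps of $\mathrm{LP}(\mu,\lambda^{(1)},\lambda^{(2)})$ lie weakly above the $x$-axis. The map $\Phi_{d,\lambda^{(1)},\lambda^{(2)}}$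 sends $\mu$ to the diagram $\nu$ obtained as follows: let $x_0\ge0$ be the smallest integer such that the restriction of $\mathrm{LP}(\mu,\lambda^{(1)},\lambda^{(2)})$ to $0\le x\le n+m-d-r$ attains its minimum $y$-value at $x=x_0$, and remove the lowest cell of column $x_0$ of $\mu$. (It is known that column $x_0$ of $\mu$ is nonempty and that $\nu$ is a partition lying in $H(d-1,\lambda^{(1)},\lambda^{(2)})$, so $\Phi_{d,\lambda^{(1)},\lambda^{(2)}}$ is a well-defined map.) -}

module Defs where

open import Data.Nat using (ℕ; zero; suc; _+_; _∸_; _≤_; _<_; _<ᵇ_; _⊔_)
open import Data.Bool using (Bool; true; false; if_then_else_)
open import Data.List using (List; []; _∷_; length; filter)
open import Data.Nat.ListAction using (sum)
open import Data.List.Relation.Unary.All using (All)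
open import Data.List.Relation.Unary.Linked using (Linked)
open import Data.Integer using (ℤ; +_; -[1+_]) renaming (_+_ to _+ℤ_; _≤_ to _≤ℤ_; _<_ to _<ℤ_)
import Data.Integer.Properties as ℤP
open import Data.Nat.Properties using (_≤?_)
open import Data.Product using (_×_)
open import Relation.Nullary using (¬_; does)
open import Relation.Binary.PropositionalEquality using (_≡_)

IsPartition : List ℕ → Set
IsPartition μ = All (0 <_) μ × Linked (λ a b → b ≤ a) μ

-- row μ j = μ_{j+1} (0-indexed rows), 0 beyond the last part.
row : List ℕ → ℕ → ℕ
row []       _       = 0
row (x ∷ _)  zero    = x
row (_ ∷ xs) (suc j) = row xs j

-- col μ i = length of column i of the Young diagram (columns are
-- 1-indexed; meaningful for i ≥ 1) = number of parts ≥ i.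
col : List ℕ → ℕ → ℕ
col μ i = length (filter (λ x → i ≤? x) μ)

_⊆ᴾ_ : List ℕ → List ℕ → Set
μ ⊆ᴾ λ′ = ∀ j → row μ j ≤ row λ′ j

HorizontalStrip : List ℕ → List ℕ → Set
HorizontalStrip λ′ μ = μ ⊆ᴾ λ′ × (∀ i → col λ′ (suc i) ≤ suc (col μ (suc i)))

H : ℕ → List ℕ → List ℕ → List ℕ → Set
H k λ₁ λ₂ μ = IsPartition μ × sum μ ≡ k × HorizontalStrip λ₁ μ × HorizontalStrip λ₂ μ

inSkew : List ℕ → List ℕ → ℕ → Bool
inSkew λ′ μ i = col μ i <ᵇ col λ′ i

-- the i-th step (i ≥ 1) of LP(μ, λ¹, λ²): its y-increment
step : List ℕ → List ℕ → List ℕ → ℕ → ℤ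
step λ₁ λ₂ μ i with inSkew λ₁ μ i | inSkew λ₂ μ i
... | true  | true  = + 1
... | false | false = -[1+ 0 ]
... | _     | _     = + 0

height : List ℕ → List ℕ → List ℕ → ℕ → ℤ
height λ₁ λ₂ μ zero    = + 0
height λ₁ λ₂ μ (suc x) = height λ₁ λ₂ μ x +ℤ step λ₁ λ₂ μ (suc x)

Hplus : ℕ → List ℕ → List ℕ → List ℕ → Set
Hplus d λ₁ λ₂ μ = H d λ₁ λ₂ μ ×
  (∀ x → x ≤ row λ₁ 0 ⊔ row λ₂ 0 → + 0 ≤ℤ height λ₁ λ₂ μ x)

firstMin : (ℕ → ℤ) → ℕ → ℕ
firstMin f zero    = zero
firstMin f (suc L) with does (f (suc L) ℤP.<? f (firstMin f L))
... | true  = suc L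
... | false = firstMin f L

decRow : ℕ → List ℕ → List ℕ
decRow _       []            = []
decRow zero    (zero ∷ xs)   = xs
decRow zero    (suc zero ∷ xs) = xs
decRow zero    (suc (suc k) ∷ xs) = suc k ∷ xs
decRow (suc j) (x ∷ xs)      = x ∷ decRow j xs

-- remove the lowest cell of column c (c ≥ 1) of μ; that cell lies in
-- (1-indexed) row col μ c, i.e. 0-indexed row col μ c ∸ 1.
removeLowest : ℕ → List ℕ → List ℕ
removeLowest c μ = decRow (col μ c ∸ 1) μ

-- Φ_{d,λ¹,λ²}, where L = n + m − d − r is passed explicitly.
Φ : ℕ → List ℕ → List ℕ → List ℕ → List ℕ
Φ L λ₁ λ₂ μ = removeLowest (firstMin (height λ₁ λ₂ μ) L) μ

-- Let L = n + m − d − r and let h_μ be the lattice path of μ. Column by column,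
-- step + 1 + 2·col μ = col λ¹ + col λ², so h_μ(L) = n + m − L − 2|μ|: this is ≥ 0 for
-- μ ∈ H(d) and > 0 for μ ∈ H(d − 1), and beyond max(λ¹₁, λ²₁) the path only descends.
-- Hence μ ∉ H⁺ exactly when the first minimum x of h_μ on [0, L] is negative. Then column x
-- is full in both λ's while column x + 1 is not, so the lowest cell of column x is a corner;
-- deleting it turns the down-step at x into an up-step and lifts the path beyond x by 2,
-- which makes x − 1 the last minimum of the new path. Adding a cell at the bottom of column
-- p + 1, for p the last minimum of h_ν, reverses all of this and so inverts Φ.
module Submission where

open import Defs
open import Data.Bool using (Bool; true; false; T)
open import Data.Empty using (⊥-elim)
open import Data.Unit using (tt)
open import Data.Integer as ℤ using (ℤ; 0ℤ; 1ℤ; -1ℤ)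
import Data.Integer.Properties as ℤₚ
open import Data.Integer.Tactic.RingSolver using (solve-∀)
open import Data.List using (List; []; _∷_; [_]; length)
import Data.List.Properties as List
open import Data.List.Relation.Binary.Sublist.Propositional using (⊆-refl)
open import Data.List.Relation.Binary.Sublist.Propositional.Properties using (filter⁺; length-mono-≤)
open import Data.List.Relation.Unary.All as All using (All; []; _∷_)
open import Data.List.Relation.Unary.Linked as Linked using ([]; [-]; _∷_)
open import Data.List.Relation.Unary.Linked.Properties using (Linked⇒All)
open import Data.Nat
open import Data.Nat.ListAction using (sum)
open import Data.Nat.Properties
import Data.Nat.Tactic.RingSolver as ℕ-Solver
open import Algebra.Properties.CommutativeSemigroup +-commutativeSemigroup using (interchange)
open import Algebra.Properties.CommutativeSemigroup ℤₚ.+-commutativeSemigroup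
  using () renaming (interchange to ℤ-interchange)
open import Data.Product using (_×_; ∃; _,_; proj₁; proj₂)
open import Data.Sum using (_⊎_; inj₁; inj₂; [_,_]′)
open import Function using (_∘_)
open import Relation.Binary.Definitions using (tri<; tri≈; tri>)
open import Relation.Nullary using (¬_; does; yes; no)
open import Relation.Binary.PropositionalEquality
  using (_≡_; _≢_; refl; sym; trans; cong; cong₂; subst; subst₂; ≢-sym; module ≡-Reasoning)

-- Columns and conjugation

col-∷-accept : ∀ {i x} xs → i ≤ x → col (x ∷ xs) i ≡ suc (col xs i)
col-∷-accept {i} xs i≤x = cong length (List.filter-accept (i ≤?_) i≤x)

col-∷-reject : ∀ {i x} xs → x < i → col (x ∷ xs) i ≡ col xs i
col-∷-reject {i} xs x<i = cong length (List.filter-reject (i ≤?_) (<⇒≱ x<i))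

col-∷ : ∀ x xs i → col (x ∷ xs) i ≡ col [ x ] i + col xs i
col-∷ x xs i with i ≤? x
... | yes i≤x = trans (col-∷-accept xs i≤x) (cong (_+ col xs i) (sym (col-∷-accept [] i≤x)))
... | no i≰x =
  trans (col-∷-reject xs (≰⇒> i≰x)) (cong (_+ col xs i) (sym (col-∷-reject [] (≰⇒> i≰x))))

col≤length : ∀ xs i → col xs i ≤ length xs
col≤length xs i = List.length-filter (i ≤?_) xs

col-antitone : ∀ xs {i i′} → i ≤ i′ → col xs i′ ≤ col xs i
col-antitone xs i≤i′ =
  length-mono-≤ (filter⁺ _ _ (λ { refl i′≤x → ≤-trans i≤i′ i′≤x }) (⊆-refl {x = xs}))

col-all< : ∀ {i} xs → All (_< i) xs → col xs i ≡ 0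
col-all< xs xs<i = cong length (List.filter-none _ (All.map <⇒≱ xs<i))

IsPartition-tail : ∀ {x xs} → IsPartition (x ∷ xs) → IsPartition xs
IsPartition-tail (_ ∷ xs>0 , linked) = xs>0 , Linked.tail linked

IsPartition⇒parts≤head : ∀ {x xs} → IsPartition (x ∷ xs) → All (_≤ x) xs
IsPartition⇒parts≤head (_ , [-]) = []
IsPartition⇒parts≤head (_ , y≤x ∷ linked) =
  Linked⇒All (λ b≤a c≤b → ≤-trans c≤b b≤a) y≤x linked

IsPartition⇒parts≤row0 : ∀ {μ} → IsPartition μ → All (_≤ row μ 0) μ
IsPartition⇒parts≤row0 {[]} _ = []
IsPartition⇒parts≤row0 {x ∷ xs} μ-part = ≤-refl ∷ IsPartition⇒parts≤head μ-part

All≤⇒row≤ : ∀ {B} xs → All (_≤ B) xs → ∀ j → row xs j ≤ B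
All≤⇒row≤ [] _ _ = z≤n
All≤⇒row≤ (x ∷ xs) (x≤B ∷ _) zero = x≤B
All≤⇒row≤ (x ∷ xs) (_ ∷ xs≤B) (suc j) = All≤⇒row≤ xs xs≤B j

row-suc≤row0 : ∀ {x xs} → IsPartition (x ∷ xs) → ∀ j → row xs j ≤ x
row-suc≤row0 {xs = xs} μ-part = All≤⇒row≤ xs (IsPartition⇒parts≤head μ-part)

≤row⇒<col : ∀ {μ} → IsPartition μ → ∀ {i} j → 1 ≤ i → i ≤ row μ j → j < col μ i
≤row⇒<col {[]} _ j (s≤s _) ()
≤row⇒<col {x ∷ xs} _ zero _ i≤x = subst (0 <_) (sym (col-∷-accept xs i≤x)) z<s
≤row⇒<col {x ∷ xs} μ-part (suc j) 1≤i i≤row =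
  subst (suc j <_) (sym (col-∷-accept xs (≤-trans i≤row (row-suc≤row0 μ-part j))))
    (s≤s (≤row⇒<col (IsPartition-tail μ-part) j 1≤i i≤row))

<col⇒≤row : ∀ {μ} → IsPartition μ → ∀ {i} j → j < col μ i → i ≤ row μ j
<col⇒≤row {[]} _ j ()
<col⇒≤row {x ∷ xs} μ-part {i} j j<col with i ≤? x
<col⇒≤row {x ∷ xs} μ-part zero _ | yes i≤x = i≤x
<col⇒≤row {x ∷ xs} μ-part (suc j) j<col | yes i≤x =
  <col⇒≤row (IsPartition-tail μ-part) j (≤-pred (subst (suc j <_) (col-∷-accept xs i≤x) j<col))
... | no i≰x = ⊥-elim (n≮0 (subst (j <_) col≡0 j<col))
  where
  col≡0 : col (x ∷ xs) i ≡ 0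
  col≡0 = trans (col-∷-reject xs (≰⇒> i≰x))
    (col-all< xs (All.map (λ y≤x → ≤-<-trans y≤x (≰⇒> i≰x))
                          (IsPartition⇒parts≤head μ-part)))

col≤⇒⊆ᴾ : ∀ {ν λ′} → IsPartition ν → IsPartition λ′ →
          (∀ i → col ν (suc i) ≤ col λ′ (suc i)) → ν ⊆ᴾ λ′
col≤⇒⊆ᴾ {ν} ν-part λ-part col≤ j with row ν j in row≡
... | zero = z≤n
... | suc i = <col⇒≤row λ-part j
  (<-≤-trans (≤row⇒<col ν-part j (s≤s z≤n) (≤-reflexive (sym row≡))) (col≤ i))

⊆ᴾ⇒col≤ : ∀ {μ λ′} → IsPartition μ → IsPartition λ′ → μ ⊆ᴾ λ′ →
          ∀ i → col μ (suc i) ≤ col λ′ (suc i)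
⊆ᴾ⇒col≤ μ-part λ-part μ⊆λ i = ∀<⇒≤ λ j j<col →
  ≤row⇒<col λ-part j (s≤s z≤n) (≤-trans (<col⇒≤row μ-part j j<col) (μ⊆λ j))
  where
  ∀<⇒≤ : ∀ {a b} → (∀ j → j < a → j < b) → a ≤ b
  ∀<⇒≤ {zero} _ = z≤n
  ∀<⇒≤ {suc a} f = f a ≤-refl

rows-injective : ∀ {μ μ′} → All (0 <_) μ → All (0 <_) μ′ →
                 (∀ j → row μ j ≡ row μ′ j) → μ ≡ μ′
rows-injective {[]} {[]} _ _ _ = refl
rows-injective {[]} {_ ∷ _} _ (y>0 ∷ _) row≡ = ⊥-elim (<⇒≢ y>0 (row≡ 0))
rows-injective {_ ∷ _} {[]} (x>0 ∷ _) _ row≡ = ⊥-elim (<⇒≢ x>0 (sym (row≡ 0)))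
rows-injective {_ ∷ _} {_ ∷ _} (_ ∷ xs>0) (_ ∷ ys>0) row≡ =
  cong₂ _∷_ (row≡ 0) (rows-injective xs>0 ys>0 (row≡ ∘ suc))

cols-injective : ∀ {μ μ′} → IsPartition μ → IsPartition μ′ →
                 (∀ i → col μ (suc i) ≡ col μ′ (suc i)) → μ ≡ μ′
cols-injective μ-part μ′-part col≡ = rows-injective (proj₁ μ-part) (proj₁ μ′-part) λ j →
  ≤-antisym (col≤⇒⊆ᴾ μ-part μ′-part (≤-reflexive ∘ col≡) j)
            (col≤⇒⊆ᴾ μ′-part μ-part (≤-reflexive ∘ sym ∘ col≡) j)

-- Deleting and adding cells

∷-IsPartition : ∀ {x xs} → 0 < x → row xs 0 ≤ x → IsPartition xs → IsPartition (x ∷ xs)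
∷-IsPartition {xs = []} x>0 _ _ = x>0 ∷ [] , [-]
∷-IsPartition {xs = _ ∷ _} x>0 y≤x (ys>0 , linked) = x>0 ∷ ys>0 , y≤x ∷ linked

-- ν is μ with one cell deleted from column suc c (columns are 1-indexed).
record CellRemoved (c : ℕ) (μ ν : List ℕ) : Set where
  field
    col-other : ∀ i → i ≢ c → col ν (suc i) ≡ col μ (suc i)
    col-here  : suc (col ν (suc c)) ≡ col μ (suc c)

module _ {c μ ν} (removed : CellRemoved c μ ν) where
  open CellRemoved removed

  CellRemoved⇒col≤ : ∀ i → col ν (suc i) ≤ col μ (suc i)
  CellRemoved⇒col≤ i with i ≟ c
  ... | yes refl = subst (col ν (suc i) ≤_) col-here (n≤1+n _)
  ... | no i≢c = ≤-reflexive (col-other i i≢c)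

  HorizontalStrip-removeCell : ∀ {λ′} → IsPartition μ → IsPartition ν → IsPartition λ′ →
    col λ′ (suc c) ≤ col μ (suc c) → HorizontalStrip λ′ μ → HorizontalStrip λ′ ν
  HorizontalStrip-removeCell {λ′} μ-part ν-part λ-part full (μ⊆λ , μ-strip) =
    col≤⇒⊆ᴾ ν-part λ-part
      (λ i → ≤-trans (CellRemoved⇒col≤ i) (⊆ᴾ⇒col≤ μ-part λ-part μ⊆λ i))
    ,
    ν-strip
    where
    ν-strip : ∀ i → col λ′ (suc i) ≤ suc (col ν (suc i))
    ν-strip i with i ≟ c
    ... | yes refl = subst (col λ′ (suc i) ≤_) (sym col-here) full
    ... | no i≢c = subst (λ k → col λ′ (suc i) ≤ suc k) (sym (col-other i i≢c)) (μ-strip i)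

  HorizontalStrip-addCell : ∀ {λ′} → IsPartition μ → IsPartition ν → IsPartition λ′ →
    col ν (suc c) < col λ′ (suc c) → HorizontalStrip λ′ ν → HorizontalStrip λ′ μ
  HorizontalStrip-addCell {λ′} μ-part ν-part λ-part nonfull (ν⊆λ , ν-strip) =
    col≤⇒⊆ᴾ μ-part λ-part μ⊆λ , λ i → ≤-trans (ν-strip i) (s≤s (CellRemoved⇒col≤ i))
    where
    μ⊆λ : ∀ i → col μ (suc i) ≤ col λ′ (suc i)
    μ⊆λ i with i ≟ c
    ... | yes refl = subst (_≤ col λ′ (suc i)) col-here nonfull
    ... | no i≢c =
      subst (_≤ col λ′ (suc i)) (col-other i i≢c) (⊆ᴾ⇒col≤ ν-part λ-part ν⊆λ i)

CellRemoved-injective : ∀ {c μ μ′ ν} → IsPartition μ → IsPartition μ′ →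
                        CellRemoved c μ ν → CellRemoved c μ′ ν → μ ≡ μ′
CellRemoved-injective {c} {μ} {μ′} μ-part μ′-part removed removed′ =
  cols-injective μ-part μ′-part col≡
  where
  open CellRemoved
  col≡ : ∀ i → col μ (suc i) ≡ col μ′ (suc i)
  col≡ i with i ≟ c
  ... | yes refl = trans (sym (col-here removed)) (col-here removed′)
  ... | no i≢c = trans (sym (col-other removed i i≢c)) (col-other removed′ i i≢c)

decRow-sum : ∀ μ j → 1 ≤ row μ j → suc (sum (decRow j μ)) ≡ sum μ
decRow-sum (suc zero ∷ xs) zero _ = refl
decRow-sum (suc (suc k) ∷ xs) zero _ = refl
decRow-sum (x ∷ xs) (suc j) 1≤row = trans (sym (+-suc x _)) (cong (x +_) (decRow-sum xs j 1≤row))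

row0-decRow≤ : ∀ {μ} → IsPartition μ → ∀ j → row (decRow j μ) 0 ≤ row μ 0
row0-decRow≤ {[]} _ _ = z≤n
row0-decRow≤ {zero ∷ xs} (() ∷ _ , _) zero
row0-decRow≤ {suc zero ∷ xs} μ-part zero = row-suc≤row0 μ-part 0
row0-decRow≤ {suc (suc k) ∷ xs} _ zero = n≤1+n _
row0-decRow≤ {x ∷ xs} _ (suc j) = ≤-refl

decRow-IsPartition : ∀ {μ} → IsPartition μ → ∀ j → row μ (suc j) < row μ j →
                     IsPartition (decRow j μ)
decRow-IsPartition {[]} _ _ _ = [] , []
decRow-IsPartition {suc zero ∷ xs} μ-part zero _ = IsPartition-tail μ-part
decRow-IsPartition {suc (suc k) ∷ xs} μ-part zero shorter =
  ∷-IsPartition z<s (≤-pred shorter) (IsPartition-tail μ-part)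
decRow-IsPartition {x ∷ xs} μ-part@(x>0 ∷ _ , _) (suc j) shorter =
  ∷-IsPartition x>0 (≤-trans (row0-decRow≤ (IsPartition-tail μ-part) j) (row-suc≤row0 μ-part 0))
    (decRow-IsPartition (IsPartition-tail μ-part) j shorter)

decRow-col-other : ∀ μ j {i} → 1 ≤ i → row μ j ≢ i → col (decRow j μ) i ≡ col μ i
decRow-col-other [] j _ _ = refl
decRow-col-other (zero ∷ xs) zero 1≤i _ = sym (col-∷-reject xs 1≤i)
decRow-col-other (suc zero ∷ xs) zero 1≤i 1≢i = sym (col-∷-reject xs (≤∧≢⇒< 1≤i 1≢i))
decRow-col-other (suc (suc k) ∷ xs) zero {i} _ row≢i with i ≤? suc k
... | yes i≤k+1 = trans (col-∷-accept xs i≤k+1) (sym (col-∷-accept xs (m≤n⇒m≤1+n i≤k+1)))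
... | no i≰k+1 =
  trans (col-∷-reject xs (≰⇒> i≰k+1)) (sym (col-∷-reject xs (≤∧≢⇒< (≰⇒> i≰k+1) row≢i)))
decRow-col-other (x ∷ xs) (suc j) {i} 1≤i row≢i = begin
  col (x ∷ decRow j xs) i           ≡⟨ col-∷ x _ i ⟩
  col [ x ] i + col (decRow j xs) i ≡⟨ cong (col [ x ] i +_) (decRow-col-other xs j 1≤i row≢i) ⟩
  col [ x ] i + col xs i            ≡⟨ col-∷ x xs i ⟨
  col (x ∷ xs) i                    ∎
  where open ≡-Reasoning

decRow-col-here : ∀ μ j {i} → 1 ≤ i → row μ j ≡ i → suc (col (decRow j μ) i) ≡ col μ i
decRow-col-here [] j 1≤i refl = ⊥-elim (n≮0 1≤i)
decRow-col-here (zero ∷ xs) zero 1≤i refl = ⊥-elim (n≮0 1≤i)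
decRow-col-here (suc zero ∷ xs) zero _ refl = sym (col-∷-accept xs ≤-refl)
decRow-col-here (suc (suc k) ∷ xs) zero _ refl =
  trans (cong suc (col-∷-reject {2 + k} xs ≤-refl)) (sym (col-∷-accept {2 + k} xs ≤-refl))
decRow-col-here (x ∷ xs) (suc j) {i} 1≤i row≡i = begin
  suc (col (x ∷ decRow j xs) i)           ≡⟨ cong suc (col-∷ x _ i) ⟩
  suc (col [ x ] i + col (decRow j xs) i) ≡⟨ +-suc (col [ x ] i) _ ⟨
  col [ x ] i + suc (col (decRow j xs) i)
    ≡⟨ cong (col [ x ] i +_) (decRow-col-here xs j 1≤i row≡i) ⟩
  col [ x ] i + col xs i                  ≡⟨ col-∷ x xs i ⟨
  col (x ∷ xs) i                          ∎
  where open ≡-Reasoning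

decRow-CellRemoved : ∀ μ j c → row μ j ≡ suc c → CellRemoved c μ (decRow j μ)
decRow-CellRemoved μ j c row≡ = record
  { col-other = λ i i≢c → decRow-col-other μ j (s≤s z≤n)
                  (λ row≡i → i≢c (sym (suc-injective (trans (sym row≡) row≡i))))
  ; col-here  = decRow-col-here μ j (s≤s z≤n) row≡
  }

module _ {μ : List ℕ} (c : ℕ) (μ-part : IsPartition μ)
         (col-drop : col μ (suc (suc c)) < col μ (suc c)) where

  private
    j = col μ (suc c) ∸ 1

    col≡ : col μ (suc c) ≡ suc j
    col≡ = sym (suc-pred (col μ (suc c)) ⦃ >-nonZero (≤-<-trans z≤n col-drop) ⦄)

    row-j : row μ j ≡ suc c
    row-j = ≤-antisym
      (≮⇒≥ λ c+2≤row → <-irrefl refl (<-≤-trans (≤row⇒<col μ-part j (s≤s z≤n) c+2≤row)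
                                                (≤-pred (subst (col μ (suc (suc c)) <_) col≡ col-drop))))
      (<col⇒≤row μ-part j (subst (j <_) (sym col≡) ≤-refl))

    row-suc-j : row μ (suc j) < suc c
    row-suc-j = ≰⇒> λ c+1≤row →
      <-irrefl refl (subst (suc j <_) col≡ (≤row⇒<col μ-part (suc j) (s≤s z≤n) c+1≤row))

  removeLowest-IsPartition : IsPartition (removeLowest (suc c) μ)
  removeLowest-IsPartition =
    decRow-IsPartition μ-part j (subst (row μ (suc j) <_) (sym row-j) row-suc-j)

  removeLowest-sum : suc (sum (removeLowest (suc c) μ)) ≡ sum μ
  removeLowest-sum = decRow-sum μ j (subst (1 ≤_) (sym row-j) (s≤s z≤n))

  removeLowest-CellRemoved : CellRemoved c μ (removeLowest (suc c) μ)
  removeLowest-CellRemoved = decRow-CellRemoved μ j c row-j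

incRow : ℕ → List ℕ → List ℕ
incRow _       []       = 1 ∷ []
incRow zero    (x ∷ xs) = suc x ∷ xs
incRow (suc j) (x ∷ xs) = x ∷ incRow j xs

incRow-sum : ∀ ν j → sum (incRow j ν) ≡ suc (sum ν)
incRow-sum [] _ = refl
incRow-sum (x ∷ xs) zero = refl
incRow-sum (x ∷ xs) (suc j) = trans (cong (x +_) (incRow-sum xs j)) (+-suc x _)

incRow-row : ∀ ν j → j ≤ length ν → row (incRow j ν) j ≡ suc (row ν j)
incRow-row [] zero _ = refl
incRow-row (x ∷ xs) zero _ = refl
incRow-row (x ∷ xs) (suc j) (s≤s j≤len) = incRow-row xs j j≤len

decRow-incRow : ∀ {ν} → All (0 <_) ν → ∀ j → j ≤ length ν → decRow j (incRow j ν) ≡ ν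
decRow-incRow {[]} _ zero _ = refl
decRow-incRow {suc k ∷ xs} _ zero _ = refl
decRow-incRow {x ∷ xs} (_ ∷ xs>0) (suc j) (s≤s j≤len) = cong (x ∷_) (decRow-incRow xs>0 j j≤len)

incRow-IsPartition : ∀ {ν} → IsPartition ν → ∀ j → j ≤ length ν →
  (∀ j′ → j ≡ suc j′ → row ν j < row ν j′) → IsPartition (incRow j ν)
incRow-IsPartition {[]} _ zero _ _ = z<s ∷ [] , [-]
incRow-IsPartition {x ∷ xs} ν-part zero _ _ =
  ∷-IsPartition z<s (m≤n⇒m≤1+n (row-suc≤row0 ν-part 0)) (IsPartition-tail ν-part)
incRow-IsPartition {x ∷ xs} ν-part@(x>0 ∷ _ , _) (suc j) (s≤s j≤len) shorter =
  ∷-IsPartition x>0 (head≤ xs j (IsPartition⇒parts≤head ν-part) (shorter j refl))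
    (incRow-IsPartition (IsPartition-tail ν-part) j j≤len
      (λ j′ j≡ → shorter (suc j′) (cong suc j≡)))
  where
  head≤ : ∀ ys j → All (_≤ x) ys → row ys j < row (x ∷ ys) j → row (incRow j ys) 0 ≤ x
  head≤ [] _ _ _ = x>0
  head≤ (_ ∷ _) zero _ row<x = row<x
  head≤ (_ ∷ _) (suc _) (y≤x ∷ _) _ = y≤x

addLowest : ℕ → List ℕ → List ℕ
addLowest x ν = incRow (col ν x) ν

module _ {ν : List ℕ} (c : ℕ) (ν-part : IsPartition ν)
         (corner : c ≡ 0 ⊎ col ν (suc c) < col ν c) where

  private
    j = col ν (suc c)

    j≤len : j ≤ length ν
    j≤len = col≤length ν (suc c)

    row<c+1 : row ν j < suc c
    row<c+1 = ≰⇒> λ c+1≤row → <-irrefl refl (≤row⇒<col ν-part j (s≤s z≤n) c+1≤row)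

    row≡c : row ν j ≡ c
    row≡c = [ (λ { refl → n≤0⇒n≡0 (≤-pred row<c+1) })
            , (λ col<col → ≤-antisym (≤-pred row<c+1) (<col⇒≤row ν-part j col<col)) ]′ corner

    shorter : ∀ j′ → j ≡ suc j′ → row ν j < row ν j′
    shorter j′ j≡ = <-≤-trans row<c+1 (<col⇒≤row ν-part j′ (subst (j′ <_) (sym j≡) ≤-refl))

    decRow-addLowest : decRow j (addLowest (suc c) ν) ≡ ν
    decRow-addLowest = decRow-incRow (proj₁ ν-part) j j≤len

  addLowest-IsPartition : IsPartition (addLowest (suc c) ν)
  addLowest-IsPartition = incRow-IsPartition ν-part j j≤len shorter

  addLowest-sum : sum (addLowest (suc c) ν) ≡ suc (sum ν)
  addLowest-sum = incRow-sum ν j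

  addLowest-CellRemoved : CellRemoved c (addLowest (suc c) ν) ν
  addLowest-CellRemoved = subst (CellRemoved c _) decRow-addLowest
    (decRow-CellRemoved _ j c (trans (incRow-row ν j j≤len) (cong suc row≡c)))

  removeLowest-addLowest : removeLowest (suc c) (addLowest (suc c) ν) ≡ ν
  removeLowest-addLowest =
    trans (cong (λ k → decRow (k ∸ 1) (addLowest (suc c) ν))
                (sym (CellRemoved.col-here addLowest-CellRemoved)))
          decRow-addLowest

-- First and last minima

record IsFirstMin (f : ℕ → ℤ) (L x : ℕ) : Set where
  field
    bounded : x ≤ L
    minimal : ∀ y → y ≤ L → f x ℤ.≤ f y
    first   : ∀ y → y < x → f x ℤ.< f y

record IsLastMin (f : ℕ → ℤ) (L x : ℕ) : Set where
  field
    bounded : x ≤ L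
    minimal : ∀ y → y ≤ L → f x ℤ.≤ f y
    last    : ∀ y → x < y → y ≤ L → f x ℤ.< f y

lastMin : (ℕ → ℤ) → ℕ → ℕ
lastMin f zero    = zero
lastMin f (suc L) with does (f (suc L) ℤₚ.≤? f (lastMin f L))
... | true  = suc L
... | false = lastMin f L

private
  ≤-suc-cases : ∀ {y L} → y ≤ suc L → y ≡ suc L ⊎ y ≤ L
  ≤-suc-cases {y} {L} y≤L+1 with m≤n⇒m<n∨m≡n y≤L+1
  ... | inj₁ y<L+1 = inj₂ (≤-pred y<L+1)
  ... | inj₂ y≡L+1 = inj₁ y≡L+1

  sucℤ-cancel-≤ : ∀ {i j} → ℤ.suc i ℤ.≤ ℤ.suc j → i ℤ.≤ j
  sucℤ-cancel-≤ {i} {j} le =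
    subst₂ ℤ._≤_ (ℤₚ.pred-suc i) (ℤₚ.pred-suc j) (ℤₚ.pred-mono le)

module _ (f : ℕ → ℤ) where

  firstMin-IsFirstMin : ∀ L → IsFirstMin f L (firstMin f L)
  firstMin-IsFirstMin zero = record
    { bounded = z≤n ; minimal = λ { zero z≤n → ℤₚ.≤-refl } ; first = λ _ () }
  firstMin-IsFirstMin (suc L) with f (suc L) ℤₚ.<? f (firstMin f L)
  ... | yes new<old = record
    { bounded = ≤-refl
    ; minimal = λ y y≤L+1 → [ (λ { refl → ℤₚ.≤-refl })
                            , (λ y≤L → ℤₚ.<⇒≤ (ℤₚ.<-≤-trans new<old (minimal y y≤L))) ]′
                              (≤-suc-cases y≤L+1)
    ; first   = λ y y<L+1 → ℤₚ.<-≤-trans new<old (minimal y (≤-pred y<L+1))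
    }
    where open IsFirstMin (firstMin-IsFirstMin L)
  ... | no new≮old = record
    { bounded = m≤n⇒m≤1+n bounded
    ; minimal = λ y y≤L+1 →
        [ (λ { refl → ℤₚ.≮⇒≥ new≮old }) , minimal y ]′ (≤-suc-cases y≤L+1)
    ; first   = first
    }
    where open IsFirstMin (firstMin-IsFirstMin L)

  lastMin-IsLastMin : ∀ L → IsLastMin f L (lastMin f L)
  lastMin-IsLastMin zero = record
    { bounded = z≤n ; minimal = λ { zero z≤n → ℤₚ.≤-refl } ; last = λ { _ () z≤n } }
  lastMin-IsLastMin (suc L) with f (suc L) ℤₚ.≤? f (lastMin f L)
  ... | yes new≤old = record
    { bounded = ≤-refl
    ; minimal = λ y y≤L+1 → [ (λ { refl → ℤₚ.≤-refl })
                            , (λ y≤L → ℤₚ.≤-trans new≤old (minimal y y≤L)) ]′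
                              (≤-suc-cases y≤L+1)
    ; last    = λ y L+1<y y≤L+1 → ⊥-elim (<⇒≱ L+1<y y≤L+1)
    }
    where open IsLastMin (lastMin-IsLastMin L)
  ... | no new≰old = record
    { bounded = m≤n⇒m≤1+n bounded
    ; minimal = λ y y≤L+1 →
        [ (λ { refl → ℤₚ.<⇒≤ (ℤₚ.≰⇒> new≰old) }) , minimal y ]′ (≤-suc-cases y≤L+1)
    ; last    = λ y x<y y≤L+1 →
        [ (λ { refl → ℤₚ.≰⇒> new≰old }) , last y x<y ]′ (≤-suc-cases y≤L+1)
    }
    where open IsLastMin (lastMin-IsLastMin L)

IsFirstMin-unique : ∀ {f L x x′} → IsFirstMin f L x → IsFirstMin f L x′ → x ≡ x′
IsFirstMin-unique {x = x} {x′} m m′ with <-cmp x x′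
... | tri≈ _ x≡x′ _ = x≡x′
... | tri< x<x′ _ _ = ⊥-elim (ℤₚ.<⇒≱ (first m′ x x<x′) (minimal m x′ (bounded m′)))
  where open IsFirstMin
... | tri> _ _ x>x′ = ⊥-elim (ℤₚ.<⇒≱ (first m x′ x>x′) (minimal m′ x (bounded m)))
  where open IsFirstMin

IsLastMin-unique : ∀ {f L x x′} → IsLastMin f L x → IsLastMin f L x′ → x ≡ x′
IsLastMin-unique {x = x} {x′} m m′ with <-cmp x x′
... | tri≈ _ x≡x′ _ = x≡x′
... | tri< x<x′ _ _ = ⊥-elim (ℤₚ.<⇒≱ (last m x′ x<x′ (bounded m′)) (minimal m′ x (bounded m)))
  where open IsLastMin
... | tri> _ _ x>x′ = ⊥-elim (ℤₚ.<⇒≱ (last m′ x x>x′ (bounded m)) (minimal m x′ (bounded m′)))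
  where open IsLastMin

module _ (f g : ℕ → ℤ) (p : ℕ)
         (agree : ∀ y → y ≤ p → f y ≡ g y)
         (shifted : ∀ y → p < y → ℤ.suc (ℤ.suc (f y)) ≡ g y)
         (drop : ℤ.suc (f (suc p)) ≡ f p)
         where

  private
    g[p]≡ : g p ≡ ℤ.suc (f (suc p))
    g[p]≡ = trans (sym (agree p ≤-refl)) (sym drop)

    below-min : ∀ {y} → y ≤ p → f (suc p) ℤ.< f y → g p ℤ.≤ g y
    below-min {y} y≤p fp+1<fy =
      subst₂ ℤ._≤_ (sym g[p]≡) (agree y y≤p) (ℤₚ.i<j⇒suc[i]≤j fp+1<fy)

    above-min : ∀ {y} → p < y → f (suc p) ℤ.≤ f y → g p ℤ.< g y
    above-min {y} p<y fp+1≤fy = subst₂ ℤ._<_ (sym g[p]≡) (shifted y p<y)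
      (ℤₚ.suc[i]≤j⇒i<j (ℤₚ.suc-mono (ℤₚ.suc-mono fp+1≤fy)))

  IsFirstMin⇒IsLastMin-shift : ∀ {L} → IsFirstMin f L (suc p) → IsLastMin g L p
  IsFirstMin⇒IsLastMin-shift fmin = record
    { bounded = <⇒≤ bounded
    ; minimal = λ y y≤L → [ (λ p<y → ℤₚ.<⇒≤ (above-min p<y (minimal y y≤L)))
                          , (λ y≤p → below-min y≤p (first y (s≤s y≤p))) ]′ (<-≤-connex p y)
    ; last    = λ y p<y y≤L → above-min p<y (minimal y y≤L)
    }
    where
    open IsFirstMin fmin

  IsLastMin⇒IsFirstMin-shift : ∀ {L} → suc p ≤ L → IsLastMin g L p → IsFirstMin f L (suc p)
  IsLastMin⇒IsFirstMin-shift p<L lmin = record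
    { bounded = p<L
    ; minimal = λ y y≤L → [ (λ p<y → sucℤ-cancel-≤ (sucℤ-cancel-≤ (ℤₚ.i<j⇒suc[i]≤j
                              (subst₂ ℤ._<_ g[p]≡ (sym (shifted y p<y)) (last y p<y y≤L)))))
                          , (λ y≤p → ℤₚ.<⇒≤ (first y (s≤s y≤p))) ]′ (<-≤-connex p y)
    ; first   = first
    }
    where
    open IsLastMin lmin
    first : ∀ y → y < suc p → f (suc p) ℤ.< f y
    first y y<p+1 = ℤₚ.suc[i]≤j⇒i<j (subst₂ ℤ._≤_ g[p]≡ (sym (agree y (≤-pred y<p+1)))
      (minimal y (≤-trans (≤-pred y<p+1) bounded)))

-- The lattice path

private
  <ᵇ≡true⇒< : ∀ {m n} → (m <ᵇ n) ≡ true → m < n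
  <ᵇ≡true⇒< {m} {n} e = <ᵇ⇒< m n (subst T (sym e) tt)

  <ᵇ≡false⇒≥ : ∀ {m n} → (m <ᵇ n) ≡ false → n ≤ m
  <ᵇ≡false⇒≥ e = ≮⇒≥ (λ m<n → subst T e (<⇒<ᵇ m<n))

  stepOf : Bool → Bool → ℤ
  stepOf true  true  = 1ℤ
  stepOf false false = -1ℤ
  stepOf _     _     = 0ℤ

ColumnStrip : List ℕ → List ℕ → ℕ → Set
ColumnStrip λ′ μ i = col μ i ≤ col λ′ i × col λ′ i ≤ suc (col μ i)

HorizontalStrip⇒ColumnStrip : ∀ {λ′ μ} → IsPartition μ → IsPartition λ′ →
                              HorizontalStrip λ′ μ → ∀ i → ColumnStrip λ′ μ (suc i)
HorizontalStrip⇒ColumnStrip μ-part λ-part (μ⊆λ , strip) i =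
  ⊆ᴾ⇒col≤ μ-part λ-part μ⊆λ i , strip i

partialSum : (ℕ → ℕ) → ℕ → ℕ
partialSum f zero    = 0
partialSum f (suc y) = partialSum f y + f (suc y)

partialSum-+ : ∀ {f g h} → (∀ i → f i ≡ g i + h i) →
               ∀ y → partialSum f y ≡ partialSum g y + partialSum h y
partialSum-+ f≡g+h zero = refl
partialSum-+ {f} {g} {h} f≡g+h (suc y) =
  trans (cong₂ _+_ (partialSum-+ f≡g+h y) (f≡g+h (suc y)))
        (interchange (partialSum g y) (partialSum h y) _ _)

partialSum-col-[]≡0 : ∀ y → partialSum (col []) y ≡ 0
partialSum-col-[]≡0 zero = refl
partialSum-col-[]≡0 (suc y) = trans (+-identityʳ _) (partialSum-col-[]≡0 y)

partialSum-col-[x]-below : ∀ x y → y ≤ x → partialSum (col [ x ]) y ≡ y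
partialSum-col-[x]-below x zero _ = refl
partialSum-col-[x]-below x (suc y) y<x =
  trans (cong₂ _+_ (partialSum-col-[x]-below x y (<⇒≤ y<x)) (col-∷-accept [] y<x)) (+-comm y 1)

partialSum-col-[x] : ∀ x y → x ≤ y → partialSum (col [ x ]) y ≡ x
partialSum-col-[x] x y x≤y with m≤n⇒m<n∨m≡n x≤y
partialSum-col-[x] x (suc y) _ | inj₁ x<y+1 =
  trans (cong₂ _+_ (partialSum-col-[x] x y (≤-pred x<y+1)) (col-∷-reject [] x<y+1)) (+-identityʳ x)
... | inj₂ refl = partialSum-col-[x]-below x x ≤-refl

partialSum-col : ∀ xs y → All (_≤ y) xs → partialSum (col xs) y ≡ sum xs
partialSum-col [] y [] = partialSum-col-[]≡0 y
partialSum-col (x ∷ xs) y (x≤y ∷ xs≤y) =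
  trans (partialSum-+ (col-∷ x xs) y)
        (cong₂ _+_ (partialSum-col-[x] x y x≤y) (partialSum-col xs y xs≤y))

private
  -a+[a+u]≡u : ∀ a u → ℤ.- a ℤ.+ (a ℤ.+ u) ≡ u
  -a+[a+u]≡u = solve-∀

  +ℤ-cancelˡ-≤ : ∀ a {s t} → a ℤ.+ s ℤ.≤ a ℤ.+ t → s ℤ.≤ t
  +ℤ-cancelˡ-≤ a {s} {t} le =
    subst₂ ℤ._≤_ (-a+[a+u]≡u a s) (-a+[a+u]≡u a t) (ℤₚ.+-monoʳ-≤ (ℤ.- a) le)

  +ℤ-cancelˡ-< : ∀ a {s t} → a ℤ.+ s ℤ.< a ℤ.+ t → s ℤ.< t
  +ℤ-cancelˡ-< a {s} {t} lt =
    subst₂ ℤ._<_ (-a+[a+u]≡u a s) (-a+[a+u]≡u a t) (ℤₚ.+-monoʳ-< (ℤ.- a) lt)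

module LatticePath (λ₁ λ₂ : List ℕ) where

  private
    step≡stepOf : ∀ μ i → step λ₁ λ₂ μ i ≡ stepOf (inSkew λ₁ μ i) (inSkew λ₂ μ i)
    step≡stepOf μ i with inSkew λ₁ μ i | inSkew λ₂ μ i
    ... | true  | true  = refl
    ... | true  | false = refl
    ... | false | true  = refl
    ... | false | false = refl

  step-cong : ∀ {μ ν} i → col μ i ≡ col ν i → step λ₁ λ₂ μ i ≡ step λ₁ λ₂ ν i
  step-cong {μ} {ν} i col≡ = begin
    step λ₁ λ₂ μ i                                     ≡⟨ step≡stepOf μ i ⟩
    stepOf (col μ i <ᵇ col λ₁ i) (col μ i <ᵇ col λ₂ i)
      ≡⟨ cong (λ k → stepOf (k <ᵇ col λ₁ i) (k <ᵇ col λ₂ i)) col≡ ⟩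
    stepOf (col ν i <ᵇ col λ₁ i) (col ν i <ᵇ col λ₂ i) ≡⟨ step≡stepOf ν i ⟨
    step λ₁ λ₂ ν i                                     ∎
    where open ≡-Reasoning

  step≡-1 : ∀ μ i → col λ₁ i ≤ col μ i → col λ₂ i ≤ col μ i →
            step λ₁ λ₂ μ i ≡ -1ℤ
  step≡-1 μ i full₁ full₂ with inSkew λ₁ μ i in e₁ | inSkew λ₂ μ i in e₂
  ... | true  | _     = ⊥-elim (<⇒≱ (<ᵇ≡true⇒< e₁) full₁)
  ... | false | true  = ⊥-elim (<⇒≱ (<ᵇ≡true⇒< e₂) full₂)
  ... | false | false = refl

  step≡1 : ∀ μ i → col μ i < col λ₁ i → col μ i < col λ₂ i → step λ₁ λ₂ μ i ≡ 1ℤ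
  step≡1 μ i free₁ free₂ with inSkew λ₁ μ i in e₁ | inSkew λ₂ μ i in e₂
  ... | true  | true  = refl
  ... | true  | false = ⊥-elim (<⇒≱ free₂ (<ᵇ≡false⇒≥ e₂))
  ... | false | _     = ⊥-elim (<⇒≱ free₁ (<ᵇ≡false⇒≥ e₁))

  step<0⇒full : ∀ μ i → step λ₁ λ₂ μ i ℤ.< 0ℤ →
                col λ₁ i ≤ col μ i × col λ₂ i ≤ col μ i
  step<0⇒full μ i step<0 with inSkew λ₁ μ i in e₁ | inSkew λ₂ μ i in e₂
  step<0⇒full μ i (ℤ.+<+ ()) | true  | true
  step<0⇒full μ i (ℤ.+<+ ()) | true  | false
  step<0⇒full μ i (ℤ.+<+ ()) | false | true
  ... | false | false = <ᵇ≡false⇒≥ e₁ , <ᵇ≡false⇒≥ e₂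

  step>0⇒free : ∀ μ i → 0ℤ ℤ.< step λ₁ λ₂ μ i →
                col μ i < col λ₁ i × col μ i < col λ₂ i
  step>0⇒free μ i step>0 with inSkew λ₁ μ i in e₁ | inSkew λ₂ μ i in e₂
  ... | true  | true  = <ᵇ≡true⇒< e₁ , <ᵇ≡true⇒< e₂
  step>0⇒free μ i (ℤ.+<+ ()) | true  | false
  step>0⇒free μ i (ℤ.+<+ ()) | false | true
  step>0⇒free μ i () | false | false

  step≥0⇒free : ∀ μ i → 0ℤ ℤ.≤ step λ₁ λ₂ μ i →
                col μ i < col λ₁ i ⊎ col μ i < col λ₂ i
  step≥0⇒free μ i step≥0 with inSkew λ₁ μ i in e₁ | inSkew λ₂ μ i in e₂
  ... | true  | _     = inj₁ (<ᵇ≡true⇒< e₁)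
  ... | false | true  = inj₂ (<ᵇ≡true⇒< e₂)
  step≥0⇒free μ i () | false | false

  step≤0⇒full : ∀ μ i → step λ₁ λ₂ μ i ℤ.≤ 0ℤ →
                col λ₁ i ≤ col μ i ⊎ col λ₂ i ≤ col μ i
  step≤0⇒full μ i step≤0 with inSkew λ₁ μ i in e₁ | inSkew λ₂ μ i in e₂
  step≤0⇒full μ i (ℤ.+≤+ ()) | true  | true
  ... | true  | false = inj₂ (<ᵇ≡false⇒≥ e₂)
  ... | false | _     = inj₁ (<ᵇ≡false⇒≥ e₁)

  module _ (μ : List ℕ) (y : ℕ) where

    private
      h = height λ₁ λ₂ μ y
      s = step λ₁ λ₂ μ (suc y)
      h+0 : h ≡ h ℤ.+ 0ℤ
      h+0 = sym (ℤₚ.+-identityʳ h)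

    height-descent⇒step<0 : height λ₁ λ₂ μ (suc y) ℤ.< h → s ℤ.< 0ℤ
    height-descent⇒step<0 lt = +ℤ-cancelˡ-< h (subst (h ℤ.+ s ℤ.<_) h+0 lt)

    height-ascent⇒step>0 : h ℤ.< height λ₁ λ₂ μ (suc y) → 0ℤ ℤ.< s
    height-ascent⇒step>0 lt = +ℤ-cancelˡ-< h (subst (ℤ._< h ℤ.+ s) h+0 lt)

    height-nondescent⇒step≥0 : h ℤ.≤ height λ₁ λ₂ μ (suc y) → 0ℤ ℤ.≤ s
    height-nondescent⇒step≥0 le = +ℤ-cancelˡ-≤ h (subst (ℤ._≤ h ℤ.+ s) h+0 le)

    height-nonascent⇒step≤0 : height λ₁ λ₂ μ (suc y) ℤ.≤ h → s ℤ.≤ 0ℤ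
    height-nonascent⇒step≤0 le = +ℤ-cancelˡ-≤ h (subst (h ℤ.+ s ℤ.≤_) h+0 le)

  step-count : ∀ μ i → ColumnStrip λ₁ μ i → ColumnStrip λ₂ μ i →
               step λ₁ λ₂ μ i ℤ.+ ℤ.+ suc (col μ i + col μ i) ≡ ℤ.+ (col λ₁ i + col λ₂ i)
  step-count μ i (μ≤λ₁ , λ₁≤) (μ≤λ₂ , λ₂≤)
    with inSkew λ₁ μ i in e₁ | inSkew λ₂ μ i in e₂
  ... | true | true
    rewrite ≤-antisym λ₁≤ (<ᵇ≡true⇒< e₁) | ≤-antisym λ₂≤ (<ᵇ≡true⇒< e₂) =
      cong (ℤ.+_ ∘ suc) (sym (+-suc (col μ i) (col μ i)))
  ... | true | false
    rewrite ≤-antisym λ₁≤ (<ᵇ≡true⇒< e₁) | ≤-antisym (<ᵇ≡false⇒≥ e₂) μ≤λ₂ =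
      refl
  ... | false | true
    rewrite ≤-antisym (<ᵇ≡false⇒≥ e₁) μ≤λ₁ | ≤-antisym λ₂≤ (<ᵇ≡true⇒< e₂) =
      cong ℤ.+_ (sym (+-suc (col μ i) (col μ i)))
  ... | false | false
    rewrite ≤-antisym (<ᵇ≡false⇒≥ e₁) μ≤λ₁ | ≤-antisym (<ᵇ≡false⇒≥ e₂) μ≤λ₂ =
      refl

  height-count : ∀ μ → (∀ i → ColumnStrip λ₁ μ (suc i) × ColumnStrip λ₂ μ (suc i)) →
    ∀ y → let Σμ = partialSum (col μ) y in
    height λ₁ λ₂ μ y ℤ.+ ℤ.+ (y + (Σμ + Σμ))
      ≡ ℤ.+ (partialSum (col λ₁) y + partialSum (col λ₂) y)
  height-count μ strips zero = refl
  height-count μ strips (suc y) = begin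
    (h ℤ.+ s) ℤ.+ ℤ.+ (suc y + ((C + c) + (C + c)))
      ≡⟨ cong (λ k → (h ℤ.+ s) ℤ.+ ℤ.+ k) (regroup y C c) ⟩
    (h ℤ.+ s) ℤ.+ (ℤ.+ (y + (C + C)) ℤ.+ ℤ.+ suc (c + c))
      ≡⟨ ℤ-interchange h s (ℤ.+ (y + (C + C))) (ℤ.+ suc (c + c)) ⟩
    (h ℤ.+ ℤ.+ (y + (C + C))) ℤ.+ (s ℤ.+ ℤ.+ suc (c + c))
      ≡⟨ cong₂ ℤ._+_ (height-count μ strips y)
                     (step-count μ (suc y) (proj₁ (strips y)) (proj₂ (strips y))) ⟩
    ℤ.+ ((A + B) + (a + b))
      ≡⟨ cong ℤ.+_ (interchange A B a b) ⟩
    ℤ.+ ((A + a) + (B + b)) ∎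
    where
    open ≡-Reasoning
    h = height λ₁ λ₂ μ y
    s = step λ₁ λ₂ μ (suc y)
    C = partialSum (col μ) y
    c = col μ (suc y)
    A = partialSum (col λ₁) y
    B = partialSum (col λ₂) y
    a = col λ₁ (suc y)
    b = col λ₂ (suc y)
    regroup : ∀ y C c → suc y + ((C + c) + (C + c)) ≡ (y + (C + C)) + suc (c + c)
    regroup = ℕ-Solver.solve-∀

  private
    sucℤ²-+ʳ : ∀ a b → 1ℤ ℤ.+ (1ℤ ℤ.+ (a ℤ.+ b)) ≡ a ℤ.+ (1ℤ ℤ.+ (1ℤ ℤ.+ b))
    sucℤ²-+ʳ = solve-∀

    sucℤ²-+ˡ : ∀ a b → 1ℤ ℤ.+ (1ℤ ℤ.+ (a ℤ.+ b)) ≡ (1ℤ ℤ.+ (1ℤ ℤ.+ a)) ℤ.+ b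
    sucℤ²-+ˡ = solve-∀

  module _ {μ ν : List ℕ} {c : ℕ}
           (steps-agree : ∀ i → i ≢ c → step λ₁ λ₂ μ (suc i) ≡ step λ₁ λ₂ ν (suc i)) where

    height-agree : ∀ y → y ≤ c → height λ₁ λ₂ μ y ≡ height λ₁ λ₂ ν y
    height-agree zero _ = refl
    height-agree (suc y) y<c =
      cong₂ ℤ._+_ (height-agree y (<⇒≤ y<c)) (steps-agree y (<⇒≢ y<c))

    height-shift : ℤ.suc (ℤ.suc (step λ₁ λ₂ μ (suc c))) ≡ step λ₁ λ₂ ν (suc c) →
                   ∀ y → c < y → ℤ.suc (ℤ.suc (height λ₁ λ₂ μ y)) ≡ height λ₁ λ₂ ν y
    height-shift step-shift (suc y) c<y+1 with m≤n⇒m<n∨m≡n (≤-pred c<y+1)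
    ... | inj₂ refl = trans (sucℤ²-+ʳ (height λ₁ λ₂ μ c) _)
                            (cong₂ ℤ._+_ (height-agree c ≤-refl) step-shift)
    ... | inj₁ c<y = trans (sucℤ²-+ˡ (height λ₁ λ₂ μ y) _)
                           (cong₂ ℤ._+_ (height-shift step-shift y c<y)
                                        (steps-agree y (≢-sym (<⇒≢ c<y))))

  module _ {c μ ν} (removed : CellRemoved c μ ν)
           (full₁ : col μ (suc c) ≡ col λ₁ (suc c)) (full₂ : col μ (suc c) ≡ col λ₂ (suc c)) where

    open CellRemoved removed

    private
      steps-agree : ∀ i → i ≢ c → step λ₁ λ₂ μ (suc i) ≡ step λ₁ λ₂ ν (suc i)
      steps-agree i i≢c = step-cong {μ} {ν} (suc i) (sym (col-other i i≢c))

      ν<μ : col ν (suc c) < col μ (suc c)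
      ν<μ = subst (col ν (suc c) <_) col-here ≤-refl

      step-shift : ℤ.suc (ℤ.suc (step λ₁ λ₂ μ (suc c))) ≡ step λ₁ λ₂ ν (suc c)
      step-shift = trans
        (cong (ℤ.suc ∘ ℤ.suc)
              (step≡-1 μ (suc c) (≤-reflexive (sym full₁)) (≤-reflexive (sym full₂))))
        (sym (step≡1 ν (suc c) (subst (_ <_) full₁ ν<μ) (subst (_ <_) full₂ ν<μ)))

    CellRemoved-height-agree : ∀ y → y ≤ c → height λ₁ λ₂ μ y ≡ height λ₁ λ₂ ν y
    CellRemoved-height-agree = height-agree steps-agree

    CellRemoved-height-shift : ∀ y → c < y →
                               ℤ.suc (ℤ.suc (height λ₁ λ₂ μ y)) ≡ height λ₁ λ₂ ν y
    CellRemoved-height-shift = height-shift steps-agree step-shift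

-- The bijection

private
  1+[i-1]≡i : ∀ i → 1ℤ ℤ.+ (i ℤ.+ ℤ.- 1ℤ) ≡ i
  1+[i-1]≡i = solve-∀

  0≤-if-+≡ : ∀ {i X Y} → i ℤ.+ ℤ.+ X ≡ ℤ.+ Y → X ≤ Y → 0ℤ ℤ.≤ i
  0≤-if-+≡ {i} {X} i+X≡Y X≤Y = +ℤ-cancelˡ-≤ (ℤ.+ X)
    (subst₂ ℤ._≤_ (sym (ℤₚ.+-identityʳ (ℤ.+ X))) (trans (sym i+X≡Y) (ℤₚ.+-comm i (ℤ.+ X)))
            (ℤ.+≤+ X≤Y))

  0<-if-+≡ : ∀ {i X Y} → i ℤ.+ ℤ.+ X ≡ ℤ.+ Y → X < Y → 0ℤ ℤ.< i
  0<-if-+≡ {i} {X} i+X≡Y X<Y = +ℤ-cancelˡ-< (ℤ.+ X)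
    (subst₂ ℤ._<_ (sym (ℤₚ.+-identityʳ (ℤ.+ X))) (trans (sym i+X≡Y) (ℤₚ.+-comm i (ℤ.+ X)))
            (ℤ.+<+ X<Y))

  pred+pred<+ : ∀ {a b} → 0 < a → a ≤ b → (a ∸ 1) + (a ∸ 1) < a + b
  pred+pred<+ {suc a} _ a+1≤b = s≤s (+-monoʳ-≤ a (≤-trans (n≤1+n a) a+1≤b))

col-drops-at : ∀ λ′ μ i → col μ (suc i) < col λ′ (suc i) → col λ′ i ≤ col μ i →
               col μ (suc i) < col μ i
col-drops-at λ′ μ i free full = <-≤-trans free (≤-trans (col-antitone λ′ (n≤1+n i)) full)

module Bijection (n m r d : ℕ) (λ₁ λ₂ : List ℕ)
  (r≤n : r ≤ n) (r≤m : r ≤ m) (0<d : 0 < d) (d≤r : d ≤ r)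
  (λ₁-part : IsPartition λ₁) (sum-λ₁ : sum λ₁ ≡ n)
  (λ₂-part : IsPartition λ₂) (sum-λ₂ : sum λ₂ ≡ m)
  (λ₁≤L : row λ₁ 0 ≤ n + m ∸ d ∸ r) (λ₂≤L : row λ₂ 0 ≤ n + m ∸ d ∸ r) where

  open LatticePath λ₁ λ₂

  private
    L M : ℕ
    L = n + m ∸ d ∸ r
    M = row λ₁ 0 ⊔ row λ₂ 0

    h : List ℕ → ℕ → ℤ
    h = height λ₁ λ₂

  L+[d+r]≡n+m : L + (d + r) ≡ n + m
  L+[d+r]≡n+m = trans (cong (_+ (d + r)) (∸-+-assoc (n + m) d r))
                      (m∸n+n≡m (+-mono-≤ (≤-trans d≤r r≤n) r≤m))

  height-at-L : ∀ {k μ} → H k λ₁ λ₂ μ → h μ L ℤ.+ ℤ.+ (L + (k + k)) ≡ ℤ.+ (n + m)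
  height-at-L {k} {μ} (μ-part , sum-μ , strip₁ , strip₂) = begin
    h μ L ℤ.+ ℤ.+ (L + (k + k))   ≡⟨ cong (λ c → h μ L ℤ.+ ℤ.+ (L + (c + c))) Σμ ⟨
    h μ L ℤ.+ ℤ.+ (L + (partialSum (col μ) L + partialSum (col μ) L))
      ≡⟨ height-count μ strips L ⟩
    ℤ.+ (partialSum (col λ₁) L + partialSum (col λ₂) L)
      ≡⟨ cong ℤ.+_ (cong₂ _+_ (Σλ λ₁-part sum-λ₁ λ₁≤L) (Σλ λ₂-part sum-λ₂ λ₂≤L)) ⟩
    ℤ.+ (n + m)                   ∎
    where
    open ≡-Reasoning
    strips : ∀ i → ColumnStrip λ₁ μ (suc i) × ColumnStrip λ₂ μ (suc i)
    strips i = HorizontalStrip⇒ColumnStrip μ-part λ₁-part strip₁ i ,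
               HorizontalStrip⇒ColumnStrip μ-part λ₂-part strip₂ i
    Σμ : partialSum (col μ) L ≡ k
    Σμ = trans (partialSum-col μ L (All.map (λ x≤ → ≤-trans x≤ (≤-trans (proj₁ strip₁ 0) λ₁≤L))
                                            (IsPartition⇒parts≤row0 μ-part)))
               sum-μ
    Σλ : ∀ {λ′ s} → IsPartition λ′ → sum λ′ ≡ s → row λ′ 0 ≤ L →
         partialSum (col λ′) L ≡ s
    Σλ {λ′} λ-part sum-λ λ≤L = trans
      (partialSum-col λ′ L (All.map (λ x≤ → ≤-trans x≤ λ≤L) (IsPartition⇒parts≤row0 λ-part)))
      sum-λ

  height-L-nonneg : ∀ {μ} → H d λ₁ λ₂ μ → 0ℤ ℤ.≤ h μ L
  height-L-nonneg μ∈H = 0≤-if-+≡ (height-at-L μ∈H)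
    (subst (L + (d + d) ≤_) L+[d+r]≡n+m (+-monoʳ-≤ L (+-monoʳ-≤ d d≤r)))

  height-L-pos : ∀ {ν} → H (d ∸ 1) λ₁ λ₂ ν → 0ℤ ℤ.< h ν L
  height-L-pos ν∈H = 0<-if-+≡ (height-at-L ν∈H)
    (subst (L + ((d ∸ 1) + (d ∸ 1)) <_) L+[d+r]≡n+m (+-monoʳ-< L (pred+pred<+ 0<d d≤r)))

  step-beyond-M : ∀ μ i → M < i → step λ₁ λ₂ μ i ≡ -1ℤ
  step-beyond-M μ i M<i = step≡-1 μ i (empty λ₁-part (m≤m⊔n _ _)) (empty λ₂-part (m≤n⊔m _ _))
    where
    empty : ∀ {λ′} → IsPartition λ′ → row λ′ 0 ≤ M → col λ′ i ≤ col μ i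
    empty {λ′} λ-part λ≤M = subst (_≤ col μ i) (sym (col-all< λ′ (All.map
      (λ x≤ → ≤-<-trans x≤ (≤-<-trans λ≤M M<i)) (IsPartition⇒parts≤row0 λ-part)))) z≤n

  height-antitone-beyond-M : ∀ μ {y} z → M ≤ y → y ≤ z → h μ z ℤ.≤ h μ y
  height-antitone-beyond-M μ zero _ z≤n = ℤₚ.≤-refl
  height-antitone-beyond-M μ (suc z) M≤y y≤z+1 with m≤n⇒m<n∨m≡n y≤z+1
  ... | inj₂ refl = ℤₚ.≤-refl
  ... | inj₁ y<z+1 = ℤₚ.≤-trans
    (subst (λ s → h μ z ℤ.+ s ℤ.≤ h μ z)
           (sym (step-beyond-M μ (suc z) (s≤s (≤-trans M≤y (≤-pred y<z+1)))))
           (ℤₚ.i≤j⇒i-k≤j 1ℤ ℤₚ.≤-refl))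
    (height-antitone-beyond-M μ z M≤y (≤-pred y<z+1))

  -- H⁺ only inspects the path up to M ≤ L, but beyond M the path descends towards h μ L ≥ 0.
  Hplus⇒nonneg : ∀ {μ} → Hplus d λ₁ λ₂ μ → ∀ y → y ≤ L → 0ℤ ℤ.≤ h μ y
  Hplus⇒nonneg {μ} (μ∈H , nonneg) y y≤L with y ≤? M
  ... | yes y≤M = nonneg y y≤M
  ... | no y≰M = ℤₚ.≤-trans (height-L-nonneg μ∈H)
                            (height-antitone-beyond-M μ L (<⇒≤ (≰⇒> y≰M)) y≤L)

  ¬Hplus⇒firstMin<0 : ∀ {μ} → H d λ₁ λ₂ μ → ¬ Hplus d λ₁ λ₂ μ →
                      h μ (firstMin (h μ) L) ℤ.< 0ℤ
  ¬Hplus⇒firstMin<0 {μ} μ∈H μ∉H⁺ with h μ (firstMin (h μ) L) ℤₚ.<? 0ℤ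
  ... | yes min<0 = min<0
  ... | no min≮0 = ⊥-elim (μ∉H⁺ (μ∈H , λ y y≤M →
    ℤₚ.≤-trans (ℤₚ.≮⇒≥ min≮0) (minimal y (≤-trans y≤M (⊔-lub λ₁≤L λ₂≤L)))))
    where open IsFirstMin (firstMin-IsFirstMin (h μ) L)

  removal-at-firstMin : ∀ {μ x} → H d λ₁ λ₂ μ → IsFirstMin (h μ) L x → h μ x ℤ.< 0ℤ →
    let ν = removeLowest x μ in
    ∃ λ p → x ≡ suc p × H (d ∸ 1) λ₁ λ₂ ν × CellRemoved p μ ν × IsLastMin (h ν) L p
  removal-at-firstMin {x = zero} _ _ h0<0 = ⊥-elim (ℤₚ.<-irrefl refl h0<0)
  removal-at-firstMin {μ} {suc p} μ∈H@(μ-part , sum-μ , strip₁ , strip₂) fmin h<0 =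
    p , refl ,
    (ν-part , cong (_∸ 1) (trans (removeLowest-sum p μ-part col-drop) sum-μ) ,
     strip-ν λ₁-part full₁ strip₁ , strip-ν λ₂-part full₂ strip₂) ,
    removed ,
    IsFirstMin⇒IsLastMin-shift (h μ) (h ν) p
      (CellRemoved-height-agree removed (exact λ₁-part strip₁ full₁) (exact λ₂-part strip₂ full₂))
      (CellRemoved-height-shift removed (exact λ₁-part strip₁ full₁) (exact λ₂-part strip₂ full₂))
      drop fmin
    where
    open IsFirstMin fmin
    x = suc p
    ν = removeLowest x μ
    x<L : x < L
    x<L = ≤∧≢⇒< bounded λ x≡L →
      ℤₚ.<⇒≱ h<0 (subst (λ z → 0ℤ ℤ.≤ h μ z) (sym x≡L) (height-L-nonneg μ∈H))
    full : col λ₁ x ≤ col μ x × col λ₂ x ≤ col μ x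
    full = step<0⇒full μ x (height-descent⇒step<0 μ p (first p ≤-refl))
    full₁ = proj₁ full
    full₂ = proj₂ full
    col-drop : col μ (suc x) < col μ x
    col-drop = [ (λ free → col-drops-at λ₁ μ x free full₁)
               , (λ free → col-drops-at λ₂ μ x free full₂) ]′
      (step≥0⇒free μ (suc x) (height-nondescent⇒step≥0 μ x (minimal (suc x) x<L)))
    ν-part : IsPartition ν
    ν-part = removeLowest-IsPartition p μ-part col-drop
    removed : CellRemoved p μ ν
    removed = removeLowest-CellRemoved p μ-part col-drop
    strip-ν : ∀ {λ′} → IsPartition λ′ → col λ′ x ≤ col μ x →
              HorizontalStrip λ′ μ → HorizontalStrip λ′ ν
    strip-ν = HorizontalStrip-removeCell removed μ-part ν-part
    exact : ∀ {λ′} → IsPartition λ′ → HorizontalStrip λ′ μ → col λ′ x ≤ col μ x →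
            col μ x ≡ col λ′ x
    exact λ-part (μ⊆λ , _) = ≤-antisym (⊆ᴾ⇒col≤ μ-part λ-part μ⊆λ p)
    drop : ℤ.suc (h μ x) ≡ h μ p
    drop = trans (cong (λ s → ℤ.suc (h μ p ℤ.+ s)) (step≡-1 μ x full₁ full₂)) (1+[i-1]≡i (h μ p))

  corner-at-lastMin : ∀ {ν} p → IsLastMin (h ν) L p →
    col ν (suc p) < col λ₁ (suc p) → col ν (suc p) < col λ₂ (suc p) →
    p ≡ 0 ⊎ col ν (suc p) < col ν p
  corner-at-lastMin zero _ _ _ = inj₁ refl
  corner-at-lastMin {ν} (suc p) lmin free₁ free₂ =
    inj₂ ([ col-drops-at λ₁ ν (suc p) free₁ , col-drops-at λ₂ ν (suc p) free₂ ]′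
          (step≤0⇒full ν (suc p)
            (height-nonascent⇒step≤0 ν p (minimal p (≤-trans (n≤1+n p) bounded)))))
    where open IsLastMin lmin

  insertion-at-lastMin : ∀ {ν} p → H (d ∸ 1) λ₁ λ₂ ν → IsLastMin (h ν) L p →
    let μ = addLowest (suc p) ν in
    H d λ₁ λ₂ μ × IsFirstMin (h μ) L (suc p) × h μ (suc p) ℤ.< 0ℤ × removeLowest (suc p) μ ≡ ν
  insertion-at-lastMin {ν} p ν∈H@(ν-part , sum-ν , strip₁ , strip₂) lmin =
    (μ-part , μ-sum , strip-μ λ₁-part free₁ strip₁ , strip-μ λ₂-part free₂ strip₂) ,
    fmin ,
    ℤₚ.suc[i]≤j⇒i<j (subst (ℤ._≤ 0ℤ) (trans (sym (agree p ≤-refl)) (sym drop)) (minimal 0 z≤n)) ,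
    removeLowest-addLowest p ν-part corner
    where
    open IsLastMin lmin
    x = suc p
    μ = addLowest x ν
    x≤L : x ≤ L
    x≤L = ≤∧≢⇒< bounded λ p≡L →
      ℤₚ.<⇒≱ (height-L-pos ν∈H) (subst (λ z → h ν z ℤ.≤ 0ℤ) p≡L (minimal 0 z≤n))
    free : col ν x < col λ₁ x × col ν x < col λ₂ x
    free = step>0⇒free ν x (height-ascent⇒step>0 ν p (last x ≤-refl x≤L))
    free₁ = proj₁ free
    free₂ = proj₂ free
    corner : p ≡ 0 ⊎ col ν x < col ν p
    corner = corner-at-lastMin p lmin free₁ free₂
    μ-part : IsPartition μ
    μ-part = addLowest-IsPartition p ν-part corner
    μ-sum : sum μ ≡ d
    μ-sum = trans (addLowest-sum p ν-part corner)
                  (trans (cong suc sum-ν) (suc-pred d ⦃ >-nonZero 0<d ⦄))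
    removed : CellRemoved p μ ν
    removed = addLowest-CellRemoved p ν-part corner
    strip-μ : ∀ {λ′} → IsPartition λ′ → col ν x < col λ′ x →
              HorizontalStrip λ′ ν → HorizontalStrip λ′ μ
    strip-μ = HorizontalStrip-addCell removed μ-part ν-part
    exact : ∀ λ′ → HorizontalStrip λ′ ν → col ν x < col λ′ x → col μ x ≡ col λ′ x
    exact _ (_ , ν-strip) free =
      trans (sym (CellRemoved.col-here removed)) (≤-antisym free (ν-strip p))
    exact₁ = exact λ₁ strip₁ free₁
    exact₂ = exact λ₂ strip₂ free₂
    agree : ∀ y → y ≤ p → h μ y ≡ h ν y
    agree = CellRemoved-height-agree removed exact₁ exact₂
    drop : ℤ.suc (h μ x) ≡ h μ p
    drop = trans (cong (λ s → ℤ.suc (h μ p ℤ.+ s))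
                       (step≡-1 μ x (≤-reflexive (sym exact₁)) (≤-reflexive (sym exact₂))))
                 (1+[i-1]≡i (h μ p))
    fmin : IsFirstMin (h μ) L x
    fmin = IsLastMin⇒IsFirstMin-shift (h μ) (h ν) p agree
             (CellRemoved-height-shift removed exact₁ exact₂) drop x≤L lmin

  Φ-spec : ∀ {μ} → H d λ₁ λ₂ μ → ¬ Hplus d λ₁ λ₂ μ →
    let ν = Φ L λ₁ λ₂ μ in
    ∃ λ p → firstMin (h μ) L ≡ suc p × H (d ∸ 1) λ₁ λ₂ ν ×
            CellRemoved p μ ν × IsLastMin (h ν) L p
  Φ-spec {μ} μ∈H μ∉H⁺ =
    removal-at-firstMin μ∈H (firstMin-IsFirstMin (h μ) L) (¬Hplus⇒firstMin<0 μ∈H μ∉H⁺)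

  Φ-into : ∀ μ → H d λ₁ λ₂ μ → ¬ Hplus d λ₁ λ₂ μ →
           H (d ∸ 1) λ₁ λ₂ (Φ L λ₁ λ₂ μ)
  Φ-into μ μ∈H μ∉H⁺ = proj₁ (proj₂ (proj₂ (Φ-spec μ∈H μ∉H⁺)))

  Φ-injective : ∀ μ μ′ → H d λ₁ λ₂ μ → ¬ Hplus d λ₁ λ₂ μ →
                H d λ₁ λ₂ μ′ → ¬ Hplus d λ₁ λ₂ μ′ →
                Φ L λ₁ λ₂ μ ≡ Φ L λ₁ λ₂ μ′ → μ ≡ μ′
  Φ-injective μ μ′ μ∈H μ∉H⁺ μ′∈H μ′∉H⁺ Φ≡Φ′ =
    let (p  , _ , _ , removed  , lmin)  = Φ-spec μ∈H μ∉H⁺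
        (p′ , _ , _ , removed′ , lmin′) = Φ-spec μ′∈H μ′∉H⁺
        p≡p′ = IsLastMin-unique (subst (λ ν → IsLastMin (h ν) L p) Φ≡Φ′ lmin) lmin′
    in CellRemoved-injective (proj₁ μ∈H) (proj₁ μ′∈H)
         (subst (CellRemoved p μ) Φ≡Φ′ removed)
         (subst (λ q → CellRemoved q μ′ _) (sym p≡p′) removed′)

  Φ-surjective : ∀ ν → H (d ∸ 1) λ₁ λ₂ ν →
                 ∃ λ μ → H d λ₁ λ₂ μ × ¬ Hplus d λ₁ λ₂ μ × Φ L λ₁ λ₂ μ ≡ ν
  Φ-surjective ν ν∈H =
    let p = lastMin (h ν) L
        μ = addLowest (suc p) ν
        (μ∈H , fmin , h<0 , removeLowest≡) = insertion-at-lastMin p ν∈H (lastMin-IsLastMin (h ν) L)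
    in μ , μ∈H ,
       (λ μ∈H⁺ → ℤₚ.<⇒≱ h<0 (Hplus⇒nonneg μ∈H⁺ (suc p) (IsFirstMin.bounded fmin))) ,
       trans (cong (λ x → removeLowest x μ) (IsFirstMin-unique (firstMin-IsFirstMin (h μ) L) fmin))
             removeLowest≡

lemma4p14 : (n m r d : ℕ) (λ₁ λ₂ : List ℕ) →
    0 < n → 0 < m → r ≤ n → r ≤ m → 0 < d → d ≤ r →
    IsPartition λ₁ → sum λ₁ ≡ n → IsPartition λ₂ → sum λ₂ ≡ m →
    row λ₁ 0 ≤ n + m ∸ d ∸ r → row λ₂ 0 ≤ n + m ∸ d ∸ r →
    (∀ μ → H d λ₁ λ₂ μ → ¬ Hplus d λ₁ λ₂ μ →
       H (d ∸ 1) λ₁ λ₂ (Φ (n + m ∸ d ∸ r) λ₁ λ₂ μ))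
    × (∀ μ μ′ → H d λ₁ λ₂ μ → ¬ Hplus d λ₁ λ₂ μ →
         H d λ₁ λ₂ μ′ → ¬ Hplus d λ₁ λ₂ μ′ →
         Φ (n + m ∸ d ∸ r) λ₁ λ₂ μ ≡ Φ (n + m ∸ d ∸ r) λ₁ λ₂ μ′ → μ ≡ μ′)
    × (∀ ν → H (d ∸ 1) λ₁ λ₂ ν →
         ∃ λ μ → H d λ₁ λ₂ μ × ¬ Hplus d λ₁ λ₂ μ ×
           Φ (n + m ∸ d ∸ r) λ₁ λ₂ μ ≡ ν)
lemma4p14 n m r d λ₁ λ₂ _ _ r≤n r≤m 0<d d≤r λ₁-part sum-λ₁ λ₂-part sum-λ₂ λ₁≤L λ₂≤L =
  Φ-into , Φ-injective , Φ-surjective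
  where
  open Bijection n m r d λ₁ λ₂ r≤n r≤m 0<d d≤r λ₁-part sum-λ₁ λ₂-part sum-λ₂ λ₁≤L λ₂≤L
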